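{- For $n\ge1$ let $a_n=\frac{4^n-1}{3}$ and $Q_n(x)=\sum_{i=1}^n x^{(a_i+3)4^{n-i}}\in\mathbf{F}_2[x]$. Then $Q_n$ and $Q_n^2$ are even polynomials, their dominant exponents are respectively $4^n$ and $2\cdot4^n$, and $h(Q_n)=h(4^n)=2^{n-1}$, $h(Q_n^2)=h(2\cdot4^n)=2^n$.
   Context: A polynomial in $\mathbf{F}_2[x]$ is even if it is zero or all its exponents are even. For an integer $k\ge0$ with binary expansion $k=\sum\beta_i2^i$: $n_3(k)=\sum_{i\text{ odd}}\beta_i2^{(i-1)/2}$, $n_5(k)=\sum_{i\ge2\text{ even}}\beta_i2^{(i-2)/2}$, $h(k)=n_3(k)+n_5(k)$. For $k,\ell$ of the same parity, $k\prec\ell$ means $h(k)<h(\ell)$, or $h(k)=h(\ell)$ and $n_5(k)<n_5(\ell)$ (a total order). The dominant exponent of a nonzero even polynomial is its largest exponent for $\prec$, and $h(P)$ is $h$ of the dominant exponent. -}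

module Defs where

open import Data.Nat using (ℕ; zero; suc; _+_; _*_; _∸_; _^_; _<_; _≡ᵇ_)
open import Data.Nat.DivMod using (_/_; _%_)
open import Data.Nat.Divisibility using (_∣_)
open import Data.Bool using (Bool; true; false; _xor_; _∧_; if_then_else_)
open import Data.List using (List; []; _∷_; replicate; _++_; map; upTo; foldr)
open import Data.Nat.ListAction using (sum)
open import Data.Product using (_×_)
open import Data.Sum using (_⊎_)
open import Relation.Binary.PropositionalEquality using (_≡_)

-- Polynomials over F₂ = Bool (true = 1, xor = +, ∧ = ·), as lists of
-- coefficients, lowest degree first.  Trailing zeros are allowed; only
-- the coefficient function matters.

Poly : Set
Poly = List Bool

coeff : Poly → ℕ → Bool
coeff []       _       = false
coeff (c ∷ _)  zero    = c
coeff (_ ∷ p)  (suc k) = coeff p k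

_⊕_ : Poly → Poly → Poly
[]      ⊕ q       = q
p       ⊕ []      = p
(a ∷ p) ⊕ (b ∷ q) = (a xor b) ∷ (p ⊕ q)

scale : Bool → Poly → Poly
scale c = map (c ∧_)

_⊗_ : Poly → Poly → Poly
[]      ⊗ q = []
(a ∷ p) ⊗ q = scale a q ⊕ (false ∷ (p ⊗ q))

X^ : ℕ → Poly
X^ e = replicate e false ++ (true ∷ [])

_∈ₚ_ : ℕ → Poly → Set
k ∈ₚ P = coeff P k ≡ true

IsEven : Poly → Set
IsEven P = ∀ k → k ∈ₚ P → 2 ∣ k

β : ℕ → ℕ → ℕ
β zero    k = k % 2
β (suc i) k = β i (k / 2)

Σ< : ℕ → (ℕ → ℕ) → ℕ
Σ< m f = sum (map f (upTo m))

isOdd : ℕ → Bool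
isOdd i = (i % 2) ≡ᵇ 1

-- all digits β i k with i > k vanish, so summing over i < k + 1 is the
-- full binary expansion.
n₃ : ℕ → ℕ
n₃ k = Σ< (suc k) (λ i → if isOdd i then β i k * 2 ^ ((i ∸ 1) / 2) else 0)

n₅ : ℕ → ℕ
n₅ k = Σ< (suc k) (λ i → if isOdd i then 0 else
                          (if i ≡ᵇ 0 then 0 else β i k * 2 ^ ((i ∸ 2) / 2)))

h : ℕ → ℕ
h k = n₃ k + n₅ k

-- the order ≺ (used only on exponents of the same parity)
_≺_ : ℕ → ℕ → Set
k ≺ l = (h k < h l) ⊎ ((h k ≡ h l) × (n₅ k < n₅ l))

IsDominant : Poly → ℕ → Set
IsDominant P e = e ∈ₚ P × (∀ k → k ∈ₚ P → (k ≡ e) ⊎ (k ≺ e))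

a : ℕ → ℕ
a n = (4 ^ n ∸ 1) / 3

Q : ℕ → Poly
Q n = foldr (λ j acc → X^ ((a (suc j) + 3) * 4 ^ (n ∸ suc j)) ⊕ acc) [] (upTo n)

{-# OPTIONS --safe #-}
-- Write a L = 1 + 4 + ⋯ + 4^(L-1). The first exponent of Q n is 4^n, and the i-th one
-- (2 ≤ i ≤ n) is 2^(2(n-i)+3) · (1 + 2 a (i-2)): in binary, a 1 at an odd position j followed
-- by i-2 ones at the even positions j+1, j+3, …. Viewing n₃ and n₅ as weighted sums of binary
-- digits, the geometric sums give h = 2^(n-1) for every exponent of Q n, while n₅ = 2^(n-1)
-- only for 4^n; so 4^n dominates. Over F₂, Q n ⊗ Q n = (Q n)(x²), and doubling an exponent
-- moves every digit up by one position, swapping the roles of n₃ and n₅: the doubled tail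
-- exponents get h < 2^n = h (2 · 4^n).
module Submission where

open import Defs
open import Data.Nat using (ℕ; _≥_; _*_; _∸_; _^_)
open import Data.Product using (_×_)
open import Relation.Binary.PropositionalEquality using (_≡_)

open import Data.Nat using (zero; suc; _+_; _<_; s≤s; z≤n; _≡ᵇ_)
open import Data.Nat.Properties
open import Data.Nat.DivMod using (_/_; _%_; m*n%n≡0; [m+kn]%n≡m%n; m*n/n≡m; m/n≤m; m<n*o⇒m/o<n; +-distrib-/-∣ʳ)
open import Data.Nat.Divisibility using (_∣_; divides; ∣m⇒∣m*n)
open import Data.Nat.Tactic.RingSolver using (solve-∀)
open import Data.Bool using (true; false; _xor_; if_then_else_)
open import Data.Bool.Properties using (∧-comm; ∧-idem; xor-assoc; xor-comm; xor-same; xor-identityʳ)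
open import Data.List using (List; []; _∷_; upTo; applyUpTo; foldr)
open import Data.List.Properties using (map-applyUpTo; map-cong)
open import Data.List.Membership.Propositional using (_∈_)
open import Data.List.Membership.Propositional.Properties using (∈-applyUpTo⁻)
open import Data.List.Relation.Unary.Any using (here; there)
open import Data.Nat.ListAction using (sum)
open import Data.Product using (∃-syntax; _,_; proj₁)
open import Data.Sum using (_⊎_; inj₁; inj₂; map₁)
open import Function using (_∘_)
open import Relation.Binary.PropositionalEquality using (_≢_; refl; sym; trans; cong; cong₂; subst; subst₂; module ≡-Reasoning)
open import Relation.Nullary using (¬_)
open import Data.Empty using (⊥-elim)

coeff-⊕ : ∀ p q k → coeff (p ⊕ q) k ≡ coeff p k xor coeff q k
coeff-⊕ []      q       k       = refl
coeff-⊕ (x ∷ p) []      k       = sym (xor-identityʳ _)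
coeff-⊕ (x ∷ p) (y ∷ q) zero    = refl
coeff-⊕ (x ∷ p) (y ∷ q) (suc k) = coeff-⊕ p q k

∈ₚ-X^⁻ : ∀ e k → k ∈ₚ X^ e → e ≡ k
∈ₚ-X^⁻ zero    zero    _ = refl
∈ₚ-X^⁻ (suc e) (suc k) k∈ = cong suc (∈ₚ-X^⁻ e k k∈)

∈ₚ-X^ : ∀ e → e ∈ₚ X^ e
∈ₚ-X^ zero    = refl
∈ₚ-X^ (suc e) = ∈ₚ-X^ e

coeff-X^-≢ : ∀ e k → e ≢ k → coeff (X^ e) k ≡ false
coeff-X^-≢ e k e≢k with coeff (X^ e) k in eq
... | true  = ⊥-elim (e≢k (∈ₚ-X^⁻ e k eq))
... | false = refl

xor≡true : ∀ x y → x xor y ≡ true → x ≡ true ⊎ y ≡ true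
xor≡true true  y _ = inj₁ refl
xor≡true false y p = inj₂ p

xor-leftComm : ∀ x y z → x xor (y xor z) ≡ y xor (x xor z)
xor-leftComm x y z = trans (sym (xor-assoc x y z)) (trans (cong (_xor z) (xor-comm x y)) (xor-assoc y x z))

coeff-⊗-∷ʳ : ∀ p c q k → coeff (p ⊗ (c ∷ q)) k ≡ coeff (scale c p ⊕ (false ∷ (p ⊗ q))) k
coeff-⊗-∷ʳ []      c q zero    = refl
coeff-⊗-∷ʳ []      c q (suc k) = refl
coeff-⊗-∷ʳ (b ∷ p) c q zero    = cong (_xor false) (∧-comm b c)
coeff-⊗-∷ʳ (b ∷ p) c q (suc k) = begin
  coeff (bq ⊕ (p ⊗ (c ∷ q))) k                   ≡⟨ coeff-⊕ bq _ k ⟩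
  coeff bq k xor coeff (p ⊗ (c ∷ q)) k           ≡⟨ cong (coeff bq k xor_) (trans (coeff-⊗-∷ʳ p c q k) (coeff-⊕ cp _ k)) ⟩
  coeff bq k xor (coeff cp k xor coeff pq k)     ≡⟨ xor-leftComm (coeff bq k) (coeff cp k) (coeff pq k) ⟩
  coeff cp k xor (coeff bq k xor coeff pq k)     ≡⟨ cong (coeff cp k xor_) (sym (coeff-⊕ bq _ k)) ⟩
  coeff cp k xor coeff (bq ⊕ pq) k               ≡⟨ sym (coeff-⊕ cp _ k) ⟩
  coeff (cp ⊕ (bq ⊕ pq)) k                       ∎
  where
  open ≡-Reasoning
  bq = scale b q
  cp = scale c p
  pq = false ∷ (p ⊗ q)

infix 30 _∘x²

_∘x² : Poly → Poly
[]      ∘x² = []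
(c ∷ p) ∘x² = c ∷ false ∷ (p ∘x²)

-- Frobenius: over F₂ the cross terms of (c + x p)² cancel.
coeff-⊗-self : ∀ p k → coeff (p ⊗ p) k ≡ coeff (p ∘x²) k
coeff-⊗-self []      k       = refl
coeff-⊗-self (c ∷ p) zero    = trans (xor-identityʳ _) (∧-idem c)
coeff-⊗-self (c ∷ p) (suc k) = begin
  coeff (cp ⊕ (p ⊗ (c ∷ p))) k               ≡⟨ coeff-⊕ cp _ k ⟩
  coeff cp k xor coeff (p ⊗ (c ∷ p)) k       ≡⟨ cong (coeff cp k xor_) (trans (coeff-⊗-∷ʳ p c p k) (coeff-⊕ cp _ k)) ⟩
  coeff cp k xor (coeff cp k xor coeff pp k) ≡⟨ sym (xor-assoc (coeff cp k) _ _) ⟩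
  (coeff cp k xor coeff cp k) xor coeff pp k ≡⟨ cong (_xor coeff pp k) (xor-same (coeff cp k)) ⟩
  coeff pp k                                 ≡⟨ shifted k ⟩
  coeff (false ∷ (p ∘x²)) k                  ∎
  where
  open ≡-Reasoning
  cp = scale c p
  pp = false ∷ (p ⊗ p)
  shifted : ∀ k → coeff pp k ≡ coeff (false ∷ (p ∘x²)) k
  shifted zero    = refl
  shifted (suc k) = coeff-⊗-self p k

coeff-∘x²-double : ∀ p m → coeff (p ∘x²) (2 * m) ≡ coeff p m
coeff-∘x²-double []      m       = refl
coeff-∘x²-double (c ∷ p) zero    = refl
coeff-∘x²-double (c ∷ p) (suc m) rewrite +-suc m (m + 0) = coeff-∘x²-double p m

∈ₚ-∘x²⁻ : ∀ p k → k ∈ₚ p ∘x² → ∃[ m ] k ≡ 2 * m × m ∈ₚ p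
∈ₚ-∘x²⁻ (c ∷ p) zero          c≡true = 0 , refl , c≡true
∈ₚ-∘x²⁻ (c ∷ p) (suc (suc k)) k∈ with m , refl , m∈p ← ∈ₚ-∘x²⁻ p k k∈ =
  suc m , cong suc (sym (+-suc m (m + 0))) , m∈p

⊗-self-even : ∀ p → IsEven (p ⊗ p)
⊗-self-even p k k∈ with m , refl , _ ← ∈ₚ-∘x²⁻ p k (trans (sym (coeff-⊗-self p k)) k∈) =
  divides m (*-comm 2 m)

monomialSum : (ℕ → ℕ) → List ℕ → Poly
monomialSum E = foldr (λ j acc → X^ (E j) ⊕ acc) []

∈ₚ-monomialSum⁻ : ∀ E l k → k ∈ₚ monomialSum E l → ∃[ j ] j ∈ l × E j ≡ k
∈ₚ-monomialSum⁻ E (j ∷ l) k k∈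
  with xor≡true _ _ (trans (sym (coeff-⊕ (X^ (E j)) _ k)) k∈)
... | inj₁ k∈X^ = j , here refl , ∈ₚ-X^⁻ (E j) k k∈X^
... | inj₂ k∈rest with j′ , j′∈l , eq ← ∈ₚ-monomialSum⁻ E l k k∈rest = j′ , there j′∈l , eq

coeff-monomialSum-∉ : ∀ E l k → (∀ j → j ∈ l → E j ≢ k) → coeff (monomialSum E l) k ≡ false
coeff-monomialSum-∉ E []      k _   = refl
coeff-monomialSum-∉ E (j ∷ l) k E≢k = trans (coeff-⊕ (X^ (E j)) _ k)
  (cong₂ _xor_ (coeff-X^-≢ (E j) k (E≢k j (here refl)))
               (coeff-monomialSum-∉ E l k (λ j′ j′∈l → E≢k j′ (there j′∈l))))

≺-irrefl : ∀ k → ¬ k ≺ k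
≺-irrefl k (inj₁ h<h)       = <-irrefl refl h<h
≺-irrefl k (inj₂ (_ , n<n)) = <-irrefl refl n<n

dominant-monomialSum : ∀ E j₀ l → (∀ j → j ∈ l → E j ≺ E j₀) →
  IsDominant (monomialSum E (j₀ ∷ l)) (E j₀)
dominant-monomialSum E j₀ l tail≺ = head∈ , bound
  where
  tail≢ : ∀ j → j ∈ l → E j ≢ E j₀
  tail≢ j j∈l eq = ≺-irrefl (E j₀) (subst (_≺ E j₀) eq (tail≺ j j∈l))

  head∈ : E j₀ ∈ₚ monomialSum E (j₀ ∷ l)
  head∈ = trans (coeff-⊕ (X^ (E j₀)) _ (E j₀))
    (cong₂ _xor_ (∈ₚ-X^ (E j₀)) (coeff-monomialSum-∉ E l (E j₀) tail≢))

  bound : ∀ k → k ∈ₚ monomialSum E (j₀ ∷ l) → k ≡ E j₀ ⊎ k ≺ E j₀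
  bound k k∈ with ∈ₚ-monomialSum⁻ E (j₀ ∷ l) k k∈
  ... | _ , here refl   , refl = inj₁ refl
  ... | j , there j∈l , refl = inj₂ (tail≺ j j∈l)

dominant-⊗-self : ∀ p e → e ∈ₚ p → (∀ k → k ∈ₚ p → k ≡ e ⊎ (2 * k) ≺ (2 * e)) →
  IsDominant (p ⊗ p) (2 * e)
dominant-⊗-self p e e∈p cases = 2e∈ , bound
  where
  2e∈ : (2 * e) ∈ₚ (p ⊗ p)
  2e∈ = trans (coeff-⊗-self p (2 * e)) (trans (coeff-∘x²-double p e) e∈p)

  bound : ∀ k → k ∈ₚ (p ⊗ p) → k ≡ 2 * e ⊎ k ≺ (2 * e)
  bound k k∈ with m , refl , m∈p ← ∈ₚ-∘x²⁻ p k (trans (sym (coeff-⊗-self p k)) k∈) =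
    map₁ (cong (2 *_)) (cases m m∈p)

Σ<-suc : ∀ m f → Σ< (suc m) f ≡ f 0 + Σ< m (f ∘ suc)
Σ<-suc m f = cong (λ xs → f 0 + sum xs)
  (trans (map-applyUpTo suc f m) (sym (map-applyUpTo (λ i → i) (f ∘ suc) m)))

Σ<-cong : ∀ m {f g : ℕ → ℕ} → (∀ i → f i ≡ g i) → Σ< m f ≡ Σ< m g
Σ<-cong m f≗g = cong sum (map-cong f≗g (upTo m))

Σ<-zero : ∀ m f → (∀ i → f i ≡ 0) → Σ< m f ≡ 0
Σ<-zero zero    f f≗0 = refl
Σ<-zero (suc m) f f≗0 = trans (Σ<-suc m f) (cong₂ _+_ (f≗0 0) (Σ<-zero m (f ∘ suc) (f≗0 ∘ suc)))

Σ<-geometric : ∀ s L → 2 ^ s + Σ< L (λ t → 2 ^ (s + t)) ≡ 2 ^ (s + L)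
Σ<-geometric s zero    = trans (+-identityʳ (2 ^ s)) (cong (2 ^_) (sym (+-identityʳ s)))
Σ<-geometric s (suc L) = begin
  2 ^ s + Σ< (suc L) (λ t → 2 ^ (s + t))              ≡⟨ cong (2 ^ s +_) (Σ<-suc L (λ t → 2 ^ (s + t))) ⟩
  2 ^ s + (2 ^ (s + 0) + Σ< L (λ t → 2 ^ (s + suc t))) ≡⟨ cong₂ (λ x y → 2 ^ s + (2 ^ x + y)) (+-identityʳ s) shift ⟩
  2 ^ s + (2 ^ s + S)                                  ≡⟨ sym (+-assoc (2 ^ s) (2 ^ s) S) ⟩
  2 ^ s + 2 ^ s + S                                    ≡⟨ cong (λ x → 2 ^ s + x + S) (sym (+-identityʳ (2 ^ s))) ⟩
  2 ^ suc s + S                                        ≡⟨ Σ<-geometric (suc s) L ⟩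
  2 ^ (suc s + L)                                      ≡⟨ cong (2 ^_) (sym (+-suc s L)) ⟩
  2 ^ (s + suc L)                                      ∎
  where
  open ≡-Reasoning
  S = Σ< L (λ t → 2 ^ (suc s + t))
  shift : Σ< L (λ t → 2 ^ (s + suc t)) ≡ S
  shift = Σ<-cong L (λ t → cong (2 ^_) (+-suc s t))

2*n%2≡0 : ∀ n → 2 * n % 2 ≡ 0
2*n%2≡0 n = trans (cong (_% 2) (*-comm 2 n)) (m*n%n≡0 n 2)

[1+2*n]%2≡1 : ∀ n → (1 + 2 * n) % 2 ≡ 1
[1+2*n]%2≡1 n = trans (cong (λ x → suc x % 2) (*-comm 2 n)) ([m+kn]%n≡m%n 1 n 2)

2*n/2≡n : ∀ n → 2 * n / 2 ≡ n
2*n/2≡n n = trans (cong (_/ 2) (*-comm 2 n)) (m*n/n≡m n 2)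

[1+2*n]/2≡n : ∀ n → (1 + 2 * n) / 2 ≡ n
[1+2*n]/2≡n n = trans (+-distrib-/-∣ʳ 1 (divides n (*-comm 2 n))) (2*n/2≡n n)

n<2^n : ∀ n → n < 2 ^ n
n<2^n zero    = s≤s z≤n
n<2^n (suc n) = begin-strict
  suc n         <⟨ s≤s (n<2^n n) ⟩
  1 + 2 ^ n     ≤⟨ +-monoˡ-≤ (2 ^ n) (m^n>0 2 n) ⟩
  2 ^ n + 2 ^ n ≡⟨ cong (2 ^ n +_) (sym (+-identityʳ (2 ^ n))) ⟩
  2 ^ suc n     ∎
  where open ≤-Reasoning

β-zero : ∀ i → β i 0 ≡ 0
β-zero zero    = refl
β-zero (suc i) = β-zero i

Σdigits : ℕ → (ℕ → ℕ) → ℕ → ℕ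
Σdigits m w k = Σ< m (λ i → β i k * w i)

Σdigits-suc : ∀ m w k → Σdigits (suc m) w k ≡ k % 2 * w 0 + Σdigits m (w ∘ suc) (k / 2)
Σdigits-suc m w k = Σ<-suc m (λ i → β i k * w i)

Σdigits-zero : ∀ m w → Σdigits m w 0 ≡ 0
Σdigits-zero m w = Σ<-zero m (λ i → β i 0 * w i) (λ i → cong (_* w i) (β-zero i))

Σdigits-+ : ∀ m d w k → k < 2 ^ m → Σdigits (m + d) w k ≡ Σdigits m w k
Σdigits-+ zero    d w zero    _          = Σdigits-zero d w
Σdigits-+ zero    d w (suc k) (s≤s ())
Σdigits-+ (suc m) d w k       k<2^[1+m] = begin
  Σdigits (suc (m + d)) w k                        ≡⟨ Σdigits-suc (m + d) w k ⟩
  k % 2 * w 0 + Σdigits (m + d) (w ∘ suc) (k / 2) ≡⟨ cong (k % 2 * w 0 +_) (Σdigits-+ m d (w ∘ suc) (k / 2) k/2<2^m) ⟩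
  k % 2 * w 0 + Σdigits m (w ∘ suc) (k / 2)       ≡⟨ sym (Σdigits-suc m w k) ⟩
  Σdigits (suc m) w k                              ∎
  where
  open ≡-Reasoning
  k/2<2^m : k / 2 < 2 ^ m
  k/2<2^m = m<n*o⇒m/o<n (subst (k <_) (*-comm 2 (2 ^ m)) k<2^[1+m])

Σdigits-stable : ∀ m m′ w k → k < 2 ^ m → k < 2 ^ m′ → Σdigits m w k ≡ Σdigits m′ w k
Σdigits-stable m m′ w k k<2^m k<2^m′ = begin
  Σdigits m w k        ≡⟨ sym (Σdigits-+ m m′ w k k<2^m) ⟩
  Σdigits (m + m′) w k ≡⟨ cong (λ x → Σdigits x w k) (+-comm m m′) ⟩
  Σdigits (m′ + m) w k ≡⟨ Σdigits-+ m′ m w k k<2^m′ ⟩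
  Σdigits m′ w k       ∎
  where open ≡-Reasoning

digitSum : (ℕ → ℕ) → ℕ → ℕ
digitSum w k = Σdigits (suc k) w k

digitSum-step : ∀ w k → digitSum w k ≡ k % 2 * w 0 + digitSum (w ∘ suc) (k / 2)
digitSum-step w k = trans (Σdigits-suc k w k)
  (cong (k % 2 * w 0 +_) (Σdigits-stable k (suc (k / 2)) (w ∘ suc) (k / 2) k/2<2^k k/2<2^[1+k/2]))
  where
  k/2<2^k : k / 2 < 2 ^ k
  k/2<2^k = ≤-<-trans (m/n≤m k 2) (n<2^n k)
  k/2<2^[1+k/2] : k / 2 < 2 ^ suc (k / 2)
  k/2<2^[1+k/2] = <-trans (n<1+n (k / 2)) (n<2^n (suc (k / 2)))

digitSum-double : ∀ w k → digitSum w (2 * k) ≡ digitSum (w ∘ suc) k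
digitSum-double w k = trans (digitSum-step w (2 * k))
  (cong₂ (λ r q → r * w 0 + digitSum (w ∘ suc) q) (2*n%2≡0 k) (2*n/2≡n k))

digitSum-suc-double : ∀ w k → digitSum w (1 + 2 * k) ≡ w 0 + digitSum (w ∘ suc) k
digitSum-suc-double w k = begin
  digitSum w (1 + 2 * k)                                          ≡⟨ digitSum-step w (1 + 2 * k) ⟩
  (1 + 2 * k) % 2 * w 0 + digitSum (w ∘ suc) ((1 + 2 * k) / 2) ≡⟨ cong₂ (λ r q → r * w 0 + digitSum (w ∘ suc) q) ([1+2*n]%2≡1 k) ([1+2*n]/2≡n k) ⟩
  1 * w 0 + digitSum (w ∘ suc) k                                  ≡⟨ cong (_+ digitSum (w ∘ suc) k) (*-identityˡ (w 0)) ⟩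
  w 0 + digitSum (w ∘ suc) k                                      ∎
  where open ≡-Reasoning

digitSum-2^* : ∀ j w k → digitSum w (2 ^ j * k) ≡ digitSum (λ i → w (j + i)) k
digitSum-2^* zero    w k = cong (digitSum w) (+-identityʳ k)
digitSum-2^* (suc j) w k = trans (cong (digitSum w) (*-assoc 2 (2 ^ j) k))
  (trans (digitSum-double w (2 ^ j * k)) (digitSum-2^* j (w ∘ suc) k))

a-of : ∀ i x → 4 ^ i ≡ 1 + 3 * x → a i ≡ x
a-of i x 4^i≡ = trans (cong (λ y → (y ∸ 1) / 3) 4^i≡)
  (trans (cong (_/ 3) (*-comm 3 x)) (m*n/n≡m x 3))

4^-step : ∀ i x → 4 ^ i ≡ 1 + 3 * x → 4 ^ suc i ≡ 1 + 3 * (1 + 4 * x)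
4^-step i x 4^i≡ = trans (cong (4 *_) 4^i≡) (identity x)
  where
  identity : ∀ x → 4 * (1 + 3 * x) ≡ 1 + 3 * (1 + 4 * x)
  identity = solve-∀

4^≡1+3*a : ∀ i → 4 ^ i ≡ 1 + 3 * a i
4^≡1+3*a zero    = refl
4^≡1+3*a (suc i) = trans 4^[1+i]≡ (cong (λ x → 1 + 3 * x) (sym (a-of (suc i) (1 + 4 * a i) 4^[1+i]≡)))
  where
  4^[1+i]≡ : 4 ^ suc i ≡ 1 + 3 * (1 + 4 * a i)
  4^[1+i]≡ = 4^-step i (a i) (4^≡1+3*a i)

a-suc : ∀ i → a (suc i) ≡ 1 + 4 * a i
a-suc i = a-of (suc i) (1 + 4 * a i) (4^-step i (a i) (4^≡1+3*a i))

digitSum-a : ∀ w L → digitSum w (a L) ≡ Σ< L (λ t → w (2 * t))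
digitSum-a w zero    = Σdigits-zero 1 w
digitSum-a w (suc L) = begin
  digitSum w (a (suc L))                ≡⟨ cong (digitSum w) (a-suc L) ⟩
  digitSum w (1 + 4 * a L)              ≡⟨ cong (λ x → digitSum w (1 + x)) (*-assoc 2 2 (a L)) ⟩
  digitSum w (1 + 2 * (2 * a L))        ≡⟨ digitSum-suc-double w (2 * a L) ⟩
  w 0 + digitSum (w ∘ suc) (2 * a L)    ≡⟨ cong (w 0 +_) (digitSum-double (w ∘ suc) (a L)) ⟩
  w 0 + digitSum (w ∘ suc ∘ suc) (a L)  ≡⟨ cong (w 0 +_) (digitSum-a (w ∘ suc ∘ suc) L) ⟩
  w 0 + Σ< L (λ t → w (2 + 2 * t))      ≡⟨ cong (w 0 +_) (Σ<-cong L (λ t → cong w (sym (*-suc 2 t)))) ⟩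
  w 0 + Σ< L (λ t → w (2 * suc t))      ≡⟨ sym (Σ<-suc L (λ t → w (2 * t))) ⟩
  Σ< (suc L) (λ t → w (2 * t))          ∎
  where open ≡-Reasoning

digitSum-2^*[1+2*a] : ∀ w j L →
  digitSum w (2 ^ j * (1 + 2 * a L)) ≡ w j + Σ< L (λ t → w (j + suc (2 * t)))
digitSum-2^*[1+2*a] w j L = begin
  digitSum w (2 ^ j * (1 + 2 * a L))                   ≡⟨ digitSum-2^* j w (1 + 2 * a L) ⟩
  digitSum (λ i → w (j + i)) (1 + 2 * a L)             ≡⟨ digitSum-suc-double (λ i → w (j + i)) (a L) ⟩
  w (j + 0) + digitSum (λ i → w (j + suc i)) (a L)     ≡⟨ cong₂ _+_ (cong w (+-identityʳ j)) (digitSum-a (λ i → w (j + suc i)) L) ⟩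
  w j + Σ< L (λ t → w (j + suc (2 * t)))               ∎
  where open ≡-Reasoning

w₃ : ℕ → ℕ
w₃ i = if isOdd i then 2 ^ ((i ∸ 1) / 2) else 0

w₅ : ℕ → ℕ
w₅ i = if isOdd i then 0 else (if i ≡ᵇ 0 then 0 else 2 ^ ((i ∸ 2) / 2))

n₃≡digitSum : ∀ k → n₃ k ≡ digitSum w₃ k
n₃≡digitSum k = Σ<-cong (suc k) term
  where
  term : ∀ i → (if isOdd i then β i k * 2 ^ ((i ∸ 1) / 2) else 0) ≡ β i k * w₃ i
  term i with isOdd i
  ... | true  = refl
  ... | false = sym (*-zeroʳ (β i k))

n₅≡digitSum : ∀ k → n₅ k ≡ digitSum w₅ k
n₅≡digitSum k = Σ<-cong (suc k) term
  where
  term : ∀ i → (if isOdd i then 0 else (if i ≡ᵇ 0 then 0 else β i k * 2 ^ ((i ∸ 2) / 2)))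
             ≡ β i k * w₅ i
  term i with isOdd i | i ≡ᵇ 0
  ... | true  | _     = sym (*-zeroʳ (β i k))
  ... | false | true  = sym (*-zeroʳ (β i k))
  ... | false | false = refl

isOdd-double : ∀ t → isOdd (2 * t) ≡ false
isOdd-double t rewrite 2*n%2≡0 t = refl

isOdd-suc-double : ∀ t → isOdd (1 + 2 * t) ≡ true
isOdd-suc-double t rewrite [1+2*n]%2≡1 t = refl

w₃-double : ∀ t → w₃ (2 * t) ≡ 0
w₃-double t rewrite isOdd-double t = refl

w₃-suc-double : ∀ t → w₃ (1 + 2 * t) ≡ 2 ^ t
w₃-suc-double t rewrite isOdd-suc-double t = cong (2 ^_) (2*n/2≡n t)

w₅-suc-double : ∀ t → w₅ (1 + 2 * t) ≡ 0
w₅-suc-double t rewrite isOdd-suc-double t = refl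

w₅-double-suc : ∀ t → w₅ (2 * suc t) ≡ 2 ^ t
w₅-double-suc t = trans (cong w₅ (*-suc 2 t)) w₅[2+2t]
  where
  w₅[2+2t] : w₅ (2 + 2 * t) ≡ 2 ^ t
  w₅[2+2t] rewrite isOdd-double t = cong (2 ^_) (2*n/2≡n t)

odd-shift-index : ∀ s t → 1 + 2 * s + suc (2 * t) ≡ 2 * suc (s + t)
odd-shift-index = solve-∀

even-shift-index : ∀ s t → 2 * suc s + suc (2 * t) ≡ 1 + 2 * suc (s + t)
even-shift-index = solve-∀

n₃-odd-shift : ∀ s L → n₃ (2 ^ (1 + 2 * s) * (1 + 2 * a L)) ≡ 2 ^ s
n₃-odd-shift s L = begin
  n₃ x                                                          ≡⟨ n₃≡digitSum x ⟩
  digitSum w₃ x                                                 ≡⟨ digitSum-2^*[1+2*a] w₃ (1 + 2 * s) L ⟩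
  w₃ (1 + 2 * s) + Σ< L (λ t → w₃ (1 + 2 * s + suc (2 * t))) ≡⟨ cong₂ _+_ (w₃-suc-double s) (Σ<-zero L _ tail) ⟩
  2 ^ s + 0                                                     ≡⟨ +-identityʳ (2 ^ s) ⟩
  2 ^ s                                                         ∎
  where
  open ≡-Reasoning
  x = 2 ^ (1 + 2 * s) * (1 + 2 * a L)
  tail : ∀ t → w₃ (1 + 2 * s + suc (2 * t)) ≡ 0
  tail t = trans (cong w₃ (odd-shift-index s t)) (w₃-double (suc (s + t)))

n₅-odd-shift : ∀ s L → n₅ (2 ^ (1 + 2 * s) * (1 + 2 * a L)) ≡ Σ< L (λ t → 2 ^ (s + t))
n₅-odd-shift s L = begin
  n₅ x                                                          ≡⟨ n₅≡digitSum x ⟩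
  digitSum w₅ x                                                 ≡⟨ digitSum-2^*[1+2*a] w₅ (1 + 2 * s) L ⟩
  w₅ (1 + 2 * s) + Σ< L (λ t → w₅ (1 + 2 * s + suc (2 * t))) ≡⟨ cong₂ _+_ (w₅-suc-double s) (Σ<-cong L tail) ⟩
  Σ< L (λ t → 2 ^ (s + t))                                      ∎
  where
  open ≡-Reasoning
  x = 2 ^ (1 + 2 * s) * (1 + 2 * a L)
  tail : ∀ t → w₅ (1 + 2 * s + suc (2 * t)) ≡ 2 ^ (s + t)
  tail t = trans (cong w₅ (odd-shift-index s t)) (w₅-double-suc (s + t))

n₃-even-shift : ∀ s L → n₃ (2 ^ (2 * suc s) * (1 + 2 * a L)) ≡ Σ< L (λ t → 2 ^ (suc s + t))
n₃-even-shift s L = begin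
  n₃ x                                                          ≡⟨ n₃≡digitSum x ⟩
  digitSum w₃ x                                                 ≡⟨ digitSum-2^*[1+2*a] w₃ (2 * suc s) L ⟩
  w₃ (2 * suc s) + Σ< L (λ t → w₃ (2 * suc s + suc (2 * t))) ≡⟨ cong₂ _+_ (w₃-double (suc s)) (Σ<-cong L tail) ⟩
  Σ< L (λ t → 2 ^ (suc s + t))                                  ∎
  where
  open ≡-Reasoning
  x = 2 ^ (2 * suc s) * (1 + 2 * a L)
  tail : ∀ t → w₃ (2 * suc s + suc (2 * t)) ≡ 2 ^ (suc s + t)
  tail t = trans (cong w₃ (even-shift-index s t)) (w₃-suc-double (suc (s + t)))

n₅-even-shift : ∀ s L → n₅ (2 ^ (2 * suc s) * (1 + 2 * a L)) ≡ 2 ^ s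
n₅-even-shift s L = begin
  n₅ x                                                          ≡⟨ n₅≡digitSum x ⟩
  digitSum w₅ x                                                 ≡⟨ digitSum-2^*[1+2*a] w₅ (2 * suc s) L ⟩
  w₅ (2 * suc s) + Σ< L (λ t → w₅ (2 * suc s + suc (2 * t))) ≡⟨ cong₂ _+_ (w₅-double-suc s) (Σ<-zero L _ tail) ⟩
  2 ^ s + 0                                                     ≡⟨ +-identityʳ (2 ^ s) ⟩
  2 ^ s                                                         ∎
  where
  open ≡-Reasoning
  x = 2 ^ (2 * suc s) * (1 + 2 * a L)
  tail : ∀ t → w₅ (2 * suc s + suc (2 * t)) ≡ 0
  tail t = trans (cong w₅ (even-shift-index s t)) (w₅-suc-double (suc (s + t)))

h-odd-shift : ∀ s L → h (2 ^ (1 + 2 * s) * (1 + 2 * a L)) ≡ 2 ^ (s + L)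
h-odd-shift s L = trans (cong₂ _+_ (n₃-odd-shift s L) (n₅-odd-shift s L)) (Σ<-geometric s L)

n₅-odd-shift< : ∀ s L → n₅ (2 ^ (1 + 2 * s) * (1 + 2 * a L)) < 2 ^ (s + L)
n₅-odd-shift< s L = begin-strict
  n₅ (2 ^ (1 + 2 * s) * (1 + 2 * a L)) ≡⟨ n₅-odd-shift s L ⟩
  Σ< L (λ t → 2 ^ (s + t))             <⟨ m<n+m _ (m^n>0 2 s) ⟩
  2 ^ s + Σ< L (λ t → 2 ^ (s + t))     ≡⟨ Σ<-geometric s L ⟩
  2 ^ (s + L)                          ∎
  where open ≤-Reasoning

h-even-shift< : ∀ s L → h (2 ^ (2 * suc s) * (1 + 2 * a L)) < 2 ^ (suc s + L)
h-even-shift< s L = begin-strict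
  h (2 ^ (2 * suc s) * (1 + 2 * a L))            ≡⟨ cong₂ _+_ (n₃-even-shift s L) (n₅-even-shift s L) ⟩
  Σ< L (λ t → 2 ^ (suc s + t)) + 2 ^ s           ≡⟨ +-comm _ (2 ^ s) ⟩
  2 ^ s + Σ< L (λ t → 2 ^ (suc s + t))           <⟨ +-monoˡ-< _ (^-monoʳ-< 2 (s≤s (s≤s z≤n)) (n<1+n s)) ⟩
  2 ^ suc s + Σ< L (λ t → 2 ^ (suc s + t))       ≡⟨ Σ<-geometric (suc s) L ⟩
  2 ^ (suc s + L)                                ∎
  where open ≤-Reasoning

-- exponent n j is the exponent of the term i = j + 1 of Q n.
exponent : ℕ → ℕ → ℕ
exponent n j = (a (suc j) + 3) * 4 ^ (n ∸ suc j)

exponent-even : ∀ n j → 2 ∣ exponent n j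
exponent-even n j = ∣m⇒∣m*n (4 ^ (n ∸ suc j))
  (divides (2 + 2 * a j) (trans (cong (_+ 3) (a-suc j)) (identity (a j))))
  where
  identity : ∀ x → 1 + 4 * x + 3 ≡ (2 + 2 * x) * 2
  identity = solve-∀

Q-even : ∀ n → IsEven (Q n)
Q-even n k k∈ with j , _ , refl ← ∈ₚ-monomialSum⁻ (exponent n) (upTo n) k k∈ = exponent-even n j

exponent-tail : ∀ m L → exponent (2 + m + L) (suc L) ≡ 2 ^ (1 + 2 * suc m) * (1 + 2 * a L)
exponent-tail m L = begin
  (a (2 + L) + 3) * 4 ^ (m + L ∸ L)           ≡⟨ cong₂ (λ x e → (x + 3) * 4 ^ e) a[2+L]≡ (m+n∸n≡m m L) ⟩
  (1 + 4 * (1 + 4 * a L) + 3) * 4 ^ m         ≡⟨ identity (a L) (4 ^ m) ⟩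
  2 * 4 ^ suc m * (1 + 2 * a L)               ≡⟨ cong (λ y → 2 * y * (1 + 2 * a L)) (^-*-assoc 2 2 (suc m)) ⟩
  2 ^ (1 + 2 * suc m) * (1 + 2 * a L)         ∎
  where
  open ≡-Reasoning
  a[2+L]≡ : a (2 + L) ≡ 1 + 4 * (1 + 4 * a L)
  a[2+L]≡ = trans (a-suc (suc L)) (cong (λ x → 1 + 4 * x) (a-suc L))
  identity : ∀ x y → (1 + 4 * (1 + 4 * x) + 3) * y ≡ 2 * (4 * y) * (1 + 2 * x)
  identity = solve-∀

2*exponent-tail : ∀ m L → 2 * exponent (2 + m + L) (suc L) ≡ 2 ^ (2 * suc (suc m)) * (1 + 2 * a L)
2*exponent-tail m L = begin
  2 * exponent (2 + m + L) (suc L)                ≡⟨ cong (2 *_) (exponent-tail m L) ⟩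
  2 * (2 ^ (1 + 2 * suc m) * (1 + 2 * a L))       ≡⟨ sym (*-assoc 2 (2 ^ (1 + 2 * suc m)) _) ⟩
  2 ^ (2 + 2 * suc m) * (1 + 2 * a L)             ≡⟨ cong (λ e → 2 ^ e * (1 + 2 * a L)) (sym (*-suc 2 (suc m))) ⟩
  2 ^ (2 * suc (suc m)) * (1 + 2 * a L)           ∎
  where open ≡-Reasoning

4^suc≡2^[2*suc] : ∀ n → 4 ^ suc n ≡ 2 ^ (2 * suc n) * (1 + 2 * a 0)
4^suc≡2^[2*suc] n = trans (^-*-assoc 2 2 (suc n)) (sym (*-identityʳ _))

2*4^≡2^[1+2*] : ∀ n → 2 * 4 ^ n ≡ 2 ^ (1 + 2 * n) * (1 + 2 * a 0)
2*4^≡2^[1+2*] n = trans (cong (2 *_) (^-*-assoc 2 2 n)) (sym (*-identityʳ _))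

h-4^suc : ∀ n → h (4 ^ suc n) ≡ 2 ^ n
h-4^suc n = trans (cong h (4^suc≡2^[2*suc] n)) (cong₂ _+_ (n₃-even-shift n 0) (n₅-even-shift n 0))

n₅-4^suc : ∀ n → n₅ (4 ^ suc n) ≡ 2 ^ n
n₅-4^suc n = trans (cong n₅ (4^suc≡2^[2*suc] n)) (n₅-even-shift n 0)

h-2*4^ : ∀ n → h (2 * 4 ^ n) ≡ 2 ^ n
h-2*4^ n = trans (cong h (2*4^≡2^[1+2*] n)) (trans (h-odd-shift n 0) (cong (2 ^_) (+-identityʳ n)))

tail-index : ∀ {n j} → j ∈ applyUpTo suc n → ∃[ m ] ∃[ L ] j ≡ suc L × n ≡ suc (m + L)
tail-index j∈ with L , s≤s L≤n′ , refl ← ∈-applyUpTo⁻ suc j∈ with m , refl ← m≤n⇒∃[o]m+o≡n L≤n′ =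
  m , L , refl , cong suc (+-comm L m)

exponent-tail-≺ : ∀ n j → j ∈ applyUpTo suc n → exponent (suc n) j ≺ (4 ^ suc n)
exponent-tail-≺ n j j∈ with m , L , refl , refl ← tail-index j∈ = inj₂ (h≡ , n₅<)
  where
  h≡ : h (exponent (2 + m + L) (suc L)) ≡ h (4 ^ (2 + m + L))
  h≡ = trans (cong h (exponent-tail m L)) (trans (h-odd-shift (suc m) L) (sym (h-4^suc (suc (m + L)))))
  n₅< : n₅ (exponent (2 + m + L) (suc L)) < n₅ (4 ^ (2 + m + L))
  n₅< = subst₂ _<_ (cong n₅ (sym (exponent-tail m L))) (sym (n₅-4^suc (suc (m + L)))) (n₅-odd-shift< (suc m) L)

2*exponent-tail-≺ : ∀ n j → j ∈ applyUpTo suc n → (2 * exponent (suc n) j) ≺ (2 * 4 ^ suc n)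
2*exponent-tail-≺ n j j∈ with m , L , refl , refl ← tail-index j∈ =
  inj₁ (subst₂ _<_ (cong h (sym (2*exponent-tail m L))) (sym (h-2*4^ (2 + m + L))) (h-even-shift< (suc m) L))

-- Q (suc n) is definitionally monomialSum (exponent (suc n)) (0 ∷ applyUpTo suc n),
-- and exponent (suc n) 0 reduces to 4 ^ suc n.
Q-dominant : ∀ n → IsDominant (Q (suc n)) (4 ^ suc n)
Q-dominant n = dominant-monomialSum (exponent (suc n)) 0 (applyUpTo suc n) (exponent-tail-≺ n)

Q²-dominant : ∀ n → IsDominant (Q (suc n) ⊗ Q (suc n)) (2 * 4 ^ suc n)
Q²-dominant n = dominant-⊗-self (Q (suc n)) (4 ^ suc n) (proj₁ (Q-dominant n)) cases
  where
  cases : ∀ k → k ∈ₚ Q (suc n) → k ≡ 4 ^ suc n ⊎ (2 * k) ≺ (2 * 4 ^ suc n)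
  cases k k∈ with ∈ₚ-monomialSum⁻ (exponent (suc n)) (upTo (suc n)) k k∈
  ... | _ , here refl , refl = inj₁ refl
  ... | j , there j∈  , refl = inj₂ (2*exponent-tail-≺ n j j∈)

mainTheorem19 : (n : ℕ) → n ≥ 1 →
    IsEven (Q n) × IsEven (Q n ⊗ Q n)
    × IsDominant (Q n) (4 ^ n) × IsDominant (Q n ⊗ Q n) (2 * 4 ^ n)
    × h (4 ^ n) ≡ 2 ^ (n ∸ 1) × h (2 * 4 ^ n) ≡ 2 ^ n
mainTheorem19 (suc n) _ =
  Q-even (suc n) , ⊗-self-even (Q (suc n)) , Q-dominant n , Q²-dominant n , h-4^suc n , h-2*4^ (suc n)
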